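{- Let $d\geq 1$ and $\mathbf{k}=(k_1,\dots,k_{d+1})$ positive integers. The quotient $\widetilde\Lambda_d/\widetilde L_{\mathbf{k}}$ is finite with \[ |\widetilde\Lambda_d/\widetilde L_{\mathbf{k}}|=\det M_{\mathbf{k}}=\prod_{i=1}^{d+1}(k_i+1)-\prod_{i=1}^{d+1}k_i, \] and the set $\widetilde F_{\mathbf{k}}$ of fundamental vectors is a system of representatives of the classes of $\widetilde\Lambda_d/\widetilde L_{\mathbf{k}}$.
   Context: Let $e_1,\dots,e_{d+1}$ be the standard basis of $\mathbb{R}^{d+1}$ and $\widetilde w_i=e_i-\frac{1}{d+1}\sum_j e_j$ (so $\widetilde w_1+\dots+\widetilde w_{d+1}=0$). $\widetilde\Lambda_d=\{a_1\widetilde w_1+\dots+a_{d+1}\widetilde w_{d+1}: a_i\in\mathbb{Z}\}$. $M_{\mathbf{k}}$ is the $(d+1)\times(d+1)$ integer matrix whose $i$-th row has entry $k_i+1$ in column $i$, entry $-k_{i+1}$ in column $i+1$ (indices cyclic mod $d+1$, so row $d+1$ has $-k_1$ in column 1), zeros elsewhere. $\widetilde L_{\mathbf{k}}=\{\sum a_i\widetilde w_i : (a_1,\dots,a_{d+1})=(b_1,\dots,b_{d+1})M_{\mathbf{k}}\text{ for some } b\in\mathbb{Z}^{d+1}\}$. The fundamental vectors are $\widetilde F_{\mathbf{k}}=\{a_1\widetilde w_1+\dots+a_{d+1}\widetilde w_{d+1}: a_i\in\mathbb{Z},\ 0\le a_i\le k_i,\ \text{at least one } a_i=0\}$. -}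

module Defs where

open import Data.Nat as ℕ using (ℕ; zero; suc)
open import Data.Nat.DivMod using (_%_; m%n<n)
open import Data.Integer as ℤ using (ℤ; +_)
open import Data.Rational as ℚ using (ℚ; _/_)
open import Data.Fin using (Fin; zero; suc; toℕ; fromℕ<; punchIn; _≟_)
open import Data.Product using (Σ; ∃; ∃-syntax; _×_; _,_)
open import Relation.Nullary using (yes; no)
open import Relation.Binary.PropositionalEquality using (_≡_)

sumℤ : ∀ n → (Fin n → ℤ) → ℤ
sumℤ zero f = + 0
sumℤ (suc n) f = f zero ℤ.+ sumℤ n (λ i → f (suc i))

prodℤ : ∀ n → (Fin n → ℤ) → ℤ
prodℤ zero f = + 1
prodℤ (suc n) f = f zero ℤ.* prodℤ n (λ i → f (suc i))

sumℚ : ∀ n → (Fin n → ℚ) → ℚ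
sumℚ zero f = ℚ.0ℚ
sumℚ (suc n) f = f zero ℚ.+ sumℚ n (λ i → f (suc i))

toℚ : ℤ → ℚ
toℚ z = z / 1

det : ∀ n → (Fin n → Fin n → ℤ) → ℤ
det zero A = + 1
det (suc n) A =
  sumℤ (suc n) (λ j → sign j ℤ.* (A zero j ℤ.* det n (λ r c → A (suc r) (punchIn j c))))
  where
  sign : Fin (suc n) → ℤ
  sign j with toℕ j % 2
  ... | zero = + 1
  ... | suc _ = ℤ.- (+ 1)

-- Indices 1..d+1 are Fin (suc d); cyclic successor i ↦ i+1 mod (d+1)
next : ∀ {d} → Fin (suc d) → Fin (suc d)
next {d} i = fromℕ< (m%n<n (suc (toℕ i)) (suc d))

M : ∀ d → (Fin (suc d) → ℕ) → Fin (suc d) → Fin (suc d) → ℤ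
M d k i j with i ≟ j
... | yes _ = + (suc (k i))
... | no _ with next i ≟ j
...   | yes _ = ℤ.- (+ (k (next i)))
...   | no _ = + 0

Vecℚ : ℕ → Set
Vecℚ d = Fin (suc d) → ℚ

_≈_ : ∀ {d} → Vecℚ d → Vecℚ d → Set
u ≈ v = ∀ j → u j ≡ v j

_-v_ : ∀ {d} → Vecℚ d → Vecℚ d → Vecℚ d
(u -v v) j = u j ℚ.- v j

w : ∀ d → Fin (suc d) → Vecℚ d
w d i j with i ≟ j
... | yes _ = ℚ.1ℚ ℚ.- (+ 1 / suc d)
... | no _ = ℚ.0ℚ ℚ.- (+ 1 / suc d)

comb : ∀ d → (Fin (suc d) → ℤ) → Vecℚ d
comb d a j = sumℚ (suc d) (λ i → toℚ (a i) ℚ.* w d i j)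

InΛ : ∀ d → Vecℚ d → Set
InΛ d v = ∃[ a ] v ≈ comb d a

rowMul : ∀ d → (Fin (suc d) → ℤ) → (Fin (suc d) → Fin (suc d) → ℤ) → Fin (suc d) → ℤ
rowMul d b A j = sumℤ (suc d) (λ i → b i ℤ.* A i j)

InL : ∀ d → (Fin (suc d) → ℕ) → Vecℚ d → Set
InL d k v = ∃[ b ] v ≈ comb d (rowMul d b (M d k))

Cong : ∀ d → (Fin (suc d) → ℕ) → Vecℚ d → Vecℚ d → Set
Cong d k u v = InL d k (u -v v)

InF : ∀ d → (Fin (suc d) → ℕ) → Vecℚ d → Set
InF d k v = Σ (Fin (suc d) → ℕ) λ a → (∀ i → a i ℕ.≤ k i) × (∃[ i ] a i ≡ 0) × v ≈ comb d (λ i → + (a i))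

-- Λ̃_d / L̃_k is finite with exactly N classes: N pairwise incongruent
-- elements of Λ̃_d meeting every class
QuotCard : ∀ d → (Fin (suc d) → ℕ) → ℕ → Set
QuotCard d k N =
  Σ (Fin N → Vecℚ d) λ r →
    (∀ t → InΛ d (r t)) ×
    (∀ t t' → Cong d k (r t) (r t') → t ≡ t') ×
    (∀ v → InΛ d v → ∃[ t ] Cong d k v (r t))

RepSystem : ∀ d → (Fin (suc d) → ℕ) → Set
RepSystem d k =
  (∀ v → InF d k v → InΛ d v) ×
  (∀ v → InΛ d v → ∃[ f ] (InF d k f × Cong d k v f)) ×
  (∀ f f' → InF d k f → InF d k f' → Cong d k f f' → f ≈ f')

{-# OPTIONS --safe #-}
-- Writing a point of Λ̃ as Σ aᵢ w̃ᵢ, two coefficient vectors give the same point iff they differ by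
-- a constant vector, and the constant vectors lie in ℤ^{d+1} M (every column of M sums to 1).  So
-- congruence modulo L̃ becomes  a − a′ = β M,  where row j of M adds kⱼ + 1 at j and subtracts
-- kⱼ₊₁ at j + 1 (cyclically).
--
-- Uniqueness: if f − f′ = β M for fundamental f, f′ and some βⱼ > 0, then (β M)ⱼ ≤ fⱼ ≤ kⱼ forces
-- β to be positive everywhere and non-increasing along the cycle, hence constant; at a zero of f
-- this gives 0 < (β M)ᵢ ≤ 0.  So β ≤ 0, symmetrically β ≥ 0, and f = f′.
--
-- Existence: on nonnegative vectors, subtracting a row of M where a coordinate exceeds its bound,
-- or subtracting 1 everywhere when no coordinate vanishes, keeps the vector nonnegative and strictly
-- lowers the positive linear form μ(a) = Σⱼ Wⱼ aⱼ with Wⱼ = Π_{l ≠ j} (k_l + 1); this stops at a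
-- fundamental vector.
--
-- Sorting fundamental vectors by their first coordinate counts Π(kᵢ + 1) − Π kᵢ of them, which is also
-- the value of det M obtained by expanding the cyclic bidiagonal matrix M along its first row.
module Submission where

open import Defs
open import Algebra.Bundles using (CommutativeMonoid; CommutativeRing)
import Algebra.Properties.CommutativeMonoid.Sum
import Algebra.Properties.Semiring.Sum
open import Data.Bool using (true; false; if_then_else_)
open import Data.Fin as Fin using (Fin; zero; suc; toℕ; fromℕ; inject₁; punchIn; punchOut; _≟_)
import Data.Fin.Properties as Finₚ
import Data.Fin.Relation.Unary.Top as Top
open import Data.Integer as ℤ using (ℤ; +_; +<+; +≤+; _+_; _-_; _*_; -_; _≤_; _<_)
import Data.Integer.Properties as ℤₚ
open import Algebra.Properties.AbelianGroup ℤₚ.+-0-abelianGroup using () renaming (∙-cancelˡ to +-cancelˡ)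
open import Data.Integer.Tactic.RingSolver using (solve-∀)
open import Data.Nat as ℕ using (ℕ; zero; suc; z≤n; s≤s)
open import Data.Nat.DivMod using (_%_; m%n<n; n%n≡0; m<n⇒m%n≡m)
import Data.Nat.Properties as ℕₚ
open import Data.Product using (∃-syntax; _×_; _,_)
open import Data.Rational as ℚ using (ℚ)
import Data.Rational.Properties as ℚₚ
open import Data.Rational.Unnormalised as ℚᵘ using (mkℚᵘ; *≡*)
import Data.Rational.Unnormalised.Properties as ℚᵘₚ
open import Data.Sign as Sign using ()
open import Data.Sum using (_⊎_; inj₁; inj₂; [_,_]′)
open import Data.Vec.Functional using (Vector; removeAt; _∷_)
open import Function using (_∘_; _↔_; Inverse; _⇔_; Equivalence; mk⇔)
open import Relation.Binary.PropositionalEquality hiding ([_])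
open import Relation.Nullary using (Dec; does; ¬_; yes; no; contradiction; _×-dec_)
open import Relation.Nullary.Decidable using (dec-true; dec-false)

module _ {a ℓ} (M : CommutativeMonoid a ℓ) where
  open CommutativeMonoid M using (Carrier; _∙_; ∙-congˡ; identityʳ)
    renaming (_≈_ to _≈ᴹ_; ε to 0#; trans to ≈-trans; reflexive to ≈-reflexive)
  open import Algebra.Properties.CommutativeMonoid.Sum M

  sum-single : ∀ {n} (t : Vector Carrier n) i → (∀ j → j ≢ i → t j ≈ᴹ 0#) → sum t ≈ᴹ t i
  sum-single {suc n} t i t≈0 = ≈-trans (sum-remove t) (≈-trans
    (∙-congˡ (≈-trans (sum-cong-≋ (λ j → t≈0 (punchIn i j) (Finₚ.punchInᵢ≢i i j))) (sum-replicate-zero n)))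
    (identityʳ (t i)))

  sum-pair : ∀ {n} (t : Vector Carrier n) {i j} → i ≢ j → (∀ l → l ≢ i → l ≢ j → t l ≈ᴹ 0#) →
             sum t ≈ᴹ t i ∙ t j
  sum-pair {suc n} t {i} {j} i≢j t≈0 = ≈-trans (sum-remove t) (∙-congˡ (≈-trans
    (sum-single (removeAt t i) (punchOut i≢j) λ l l≢ → t≈0 (punchIn i l) (Finₚ.punchInᵢ≢i i l)
      λ eq → l≢ (Finₚ.punchIn-injective i l _ (trans eq (sym (Finₚ.punchIn-punchOut i≢j)))))
    (≈-reflexive (cong t (Finₚ.punchIn-punchOut i≢j)))))

module _ {c ℓ} (R : CommutativeRing c ℓ) where
  private module R = CommutativeRing R
  open import Algebra.Properties.Semiring.Sum R.semiring using (sum; ∑-distrib-+)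
  open import Algebra.Properties.AbelianGroup R.+-abelianGroup using (ε⁻¹≈ε; ⁻¹-∙-comm)

  ∑-neg : ∀ {n} (f : Vector R.Carrier n) → sum (λ i → R.- f i) R.≈ R.- sum f
  ∑-neg {zero}  f = R.sym ε⁻¹≈ε
  ∑-neg {suc n} f = R.trans (R.+-congˡ (∑-neg (f ∘ suc))) (⁻¹-∙-comm (f zero) (sum (f ∘ suc)))

  ∑-distrib-− : ∀ {n} (f g : Vector R.Carrier n) → sum (λ i → f i R.- g i) R.≈ sum f R.- sum g
  ∑-distrib-− f g = R.trans (∑-distrib-+ f (λ i → R.- g i)) (R.+-congˡ (∑-neg g))

module ℤΣ = Algebra.Properties.Semiring.Sum (CommutativeRing.semiring ℤₚ.+-*-commutativeRing)
module ℚΣ = Algebra.Properties.Semiring.Sum (CommutativeRing.semiring ℚₚ.+-*-commutativeRing)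
module ℕΠ = Algebra.Properties.CommutativeMonoid.Sum ℕₚ.*-1-commutativeMonoid

sumℤ≡sum : ∀ n f → sumℤ n f ≡ ℤΣ.sum f
sumℤ≡sum zero    f = refl
sumℤ≡sum (suc n) f = cong (λ s → f zero + s) (sumℤ≡sum n (f ∘ suc))

sumℚ≡sum : ∀ n f → sumℚ n f ≡ ℚΣ.sum f
sumℚ≡sum zero    f = refl
sumℚ≡sum (suc n) f = cong (f zero ℚ.+_) (sumℚ≡sum n (f ∘ suc))

sumℤ-cong : ∀ n {f g : Fin n → ℤ} → (∀ i → f i ≡ g i) → sumℤ n f ≡ sumℤ n g
sumℤ-cong zero    f≗g = refl
sumℤ-cong (suc n) f≗g = cong₂ _+_ (f≗g zero) (sumℤ-cong n (f≗g ∘ suc))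

prodℤ-cong : ∀ n {f g : Fin n → ℤ} → (∀ i → f i ≡ g i) → prodℤ n f ≡ prodℤ n g
prodℤ-cong zero    f≗g = refl
prodℤ-cong (suc n) f≗g = cong₂ _*_ (f≗g zero) (prodℤ-cong n (f≗g ∘ suc))

nonneg-* : ∀ m {x} → + 0 ≤ x → + 0 ≤ + m * x
nonneg-* m 0≤x = ℤₚ.≤-trans (ℤₚ.≤-reflexive (sym (ℤₚ.*-zeroʳ (+ m)))) (ℤₚ.*-monoˡ-≤-nonNeg (+ m) 0≤x)

sum-nonneg : ∀ {n} (t : Vector ℤ n) → (∀ i → + 0 ≤ t i) → + 0 ≤ ℤΣ.sum t
sum-nonneg {zero}  t 0≤t = ℤₚ.≤-refl
sum-nonneg {suc n} t 0≤t = ℤₚ.+-mono-≤ (0≤t zero) (sum-nonneg (t ∘ suc) (0≤t ∘ suc))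

term≤sum : ∀ {n} (t : Vector ℤ n) → (∀ i → + 0 ≤ t i) → ∀ i → t i ≤ ℤΣ.sum t
term≤sum {suc n} t 0≤t i = begin
  t i                               ≡⟨ ℤₚ.+-identityʳ (t i) ⟨
  t i + + 0                         ≤⟨ ℤₚ.+-monoʳ-≤ (t i) (sum-nonneg (removeAt t i) (0≤t ∘ punchIn i)) ⟩
  t i + ℤΣ.sum (removeAt t i)       ≡⟨ ℤΣ.sum-remove t ⟨
  ℤΣ.sum t                          ∎
  where open ℤₚ.≤-Reasoning

1≤product : ∀ {n} (t : Vector ℕ n) → (∀ i → 1 ℕ.≤ t i) → 1 ℕ.≤ ℕΠ.sum t
1≤product {zero}  t 1≤t = ℕₚ.≤-refl
1≤product {suc n} t 1≤t = ℕₚ.*-mono-≤ (1≤t zero) (1≤product (t ∘ suc) (1≤t ∘ suc))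

δ : ∀ {n} → Fin n → Fin n → ℤ
δ i j with i ≟ j
... | yes _ = + 1
... | no _  = + 0

δ-diagonal : ∀ {n} (i : Fin n) → δ i i ≡ + 1
δ-diagonal i with i ≟ i
... | yes _  = refl
... | no i≢i = contradiction refl i≢i

δ-elsewhere : ∀ {n} {i j : Fin n} → i ≢ j → δ i j ≡ + 0
δ-elsewhere {i = i} {j} i≢j with i ≟ j
... | yes i≡j = contradiction i≡j i≢j
... | no _    = refl

δ-nonneg : ∀ {n} (i j : Fin n) → + 0 ≤ δ i j
δ-nonneg i j with i ≟ j
... | yes _ = +≤+ z≤n
... | no _  = +≤+ z≤n

0≤i+∣i∣ : ∀ i → + 0 ≤ i + + ℤ.∣ i ∣
0≤i+∣i∣ (+ n)      = +≤+ z≤n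
0≤i+∣i∣ ℤ.-[1+ n ] = ℤₚ.≤-reflexive (sym (ℤₚ.+-inverseˡ (+ suc n)))

-- Determinants of cyclic bidiagonal matrices

minor : ∀ {n} → (Fin (suc n) → Fin (suc n) → ℤ) → Fin (suc n) → Fin n → Fin n → ℤ
minor A j r c = A (suc r) (punchIn j c)

-- The sign of a Laplace term in `det` is a where-bound function, so it cannot be named and a
-- term cannot be rewritten on its own.  Abstracting ∣_∣ turns every product into `mulWith ∣_∣′`,
-- where that sign is an argument of the variable ∣_∣′ and is found by unification.
mulWith : (ℤ → ℕ) → ℤ → ℤ → ℤ
mulWith ∣_∣′ i j = (ℤ.sign i Sign.* ℤ.sign j) ℤ.◃ (∣ i ∣′ ℕ.* ∣ j ∣′)

det-cong : ∀ n {A B : Fin n → Fin n → ℤ} → (∀ i j → A i j ≡ B i j) → det n A ≡ det n B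
det-cong zero    A≗B = refl
det-cong (suc n) A≗B with ℤ.∣_∣
... | ∣_∣′ = cong₂ _+_ (first (A≗B zero zero) (det-cong n λ r c → A≗B (suc r) (suc c)))
                      (sumℤ-cong n λ j → term (A≗B zero (suc j)) (det-cong n λ r c → A≗B (suc r) (punchIn (suc j) c)))
  where
  term : ∀ {s x x′ D D′} → x ≡ x′ → D ≡ D′ →
         mulWith ∣_∣′ s (mulWith ∣_∣′ x D) ≡ mulWith ∣_∣′ s (mulWith ∣_∣′ x′ D′)
  term refl refl = refl
  first : ∀ {x x′ D D′} → x ≡ x′ → D ≡ D′ →
          ℤ.sign (mulWith ∣_∣′ x D) ℤ.◃ (∣ mulWith ∣_∣′ x D ∣′ ℕ.+ 0) ≡
          ℤ.sign (mulWith ∣_∣′ x′ D′) ℤ.◃ (∣ mulWith ∣_∣′ x′ D′ ∣′ ℕ.+ 0)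
  first refl refl = refl

firstRow : ∀ {n} → ℤ → ℤ → (Fin (suc n) → Fin (suc (suc n)) → ℤ) → Fin (suc (suc n)) → Fin (suc (suc n)) → ℤ
firstRow x y R zero    zero          = x
firstRow x y R zero    (suc zero)    = y
firstRow x y R zero    (suc (suc _)) = + 0
firstRow x y R (suc r) c             = R r c

-- The vanishing Laplace terms (sign · 0) do not reduce either; they coincide with those of the
-- same kind of matrix two sizes smaller, where they are known to sum to 0.
det-firstRow : ∀ n x y (R : Fin (suc n) → Fin (suc (suc n)) → ℤ) →
               det (suc (suc n)) (firstRow x y R) ≡
               + 1 * (x * det (suc n) (λ r c → R r (punchIn zero c))) + (- + 1 * (y * det (suc n) (λ r c → R r (punchIn (suc zero) c))) + + 0)
det-firstRow zero          x y R = refl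
det-firstRow (suc zero)    x y R = refl
det-firstRow (suc (suc n)) x y R = cong (λ t → X x y R + (Y x y R + t))
  (trans (ℤₚ.+-identityˡ _) (trans (ℤₚ.+-identityˡ _) (+-cancelˡ (Y x y O) _ _ (+-cancelˡ (X x y O) _ _ (det-firstRow n x y O)))))
  where
  X Y : ∀ {m} → ℤ → ℤ → (Fin (suc m) → Fin (suc (suc m)) → ℤ) → ℤ
  X x y R = + 1 * (x * det _ (λ r c → R r (punchIn zero c)))
  Y x y R = - + 1 * (y * det _ (λ r c → R r (punchIn (suc zero) c)))
  O : Fin (suc n) → Fin (suc (suc n)) → ℤ
  O _ _ = + 0

det-expand : ∀ n (A : Fin (suc (suc n)) → Fin (suc (suc n)) → ℤ) → (∀ j → A zero (suc (suc j)) ≡ + 0) →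
             det (suc (suc n)) A ≡ A zero zero * det (suc n) (minor A zero) - A zero (suc zero) * det (suc n) (minor A (suc zero))
det-expand n A row₀ = begin
  det (suc (suc n)) A                                            ≡⟨ det-cong (suc (suc n)) A≗ ⟩
  det (suc (suc n)) (firstRow (A zero zero) (A zero (suc zero)) (A ∘ suc))
                                                                 ≡⟨ det-firstRow n (A zero zero) (A zero (suc zero)) (A ∘ suc) ⟩
  + 1 * X + (- + 1 * Y + + 0)                                    ≡⟨ signs X Y ⟩
  X - Y                                                          ∎
  where
  open ≡-Reasoning
  X = A zero zero * det (suc n) (minor A zero)
  Y = A zero (suc zero) * det (suc n) (minor A (suc zero))
  A≗ : ∀ i j → A i j ≡ firstRow (A zero zero) (A zero (suc zero)) (A ∘ suc) i j
  A≗ zero    zero          = refl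
  A≗ zero    (suc zero)    = refl
  A≗ zero    (suc (suc j)) = row₀ j
  A≗ (suc r) c             = refl
  signs : ∀ X Y → + 1 * X + (- + 1 * Y + + 0) ≡ X - Y
  signs = solve-∀

infixl 7 _when_

_when_ : ∀ {p} {P : Set p} → ℤ → Dec P → ℤ
x when P? = if does P? then x else + 0

when-yes : ∀ {p} {P : Set p} {x} (P? : Dec P) → P → x when P? ≡ x
when-yes {x = x} P? p = cong (λ b → if b then x else + 0) (dec-true P? p)

when-no : ∀ {p} {P : Set p} {x} (P? : Dec P) → ¬ P → x when P? ≡ + 0
when-no {x = x} P? ¬p = cong (λ b → if b then x else + 0) (dec-false P? ¬p)

0-when : ∀ {p} {P : Set p} (P? : Dec P) → + 0 when P? ≡ + 0
0-when P? with does P?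
... | true  = refl
... | false = refl

-- a on the diagonal, − b on the superdiagonal and c in the bottom left corner
bidiagonal : ∀ {n} → (a b : Fin n → ℤ) → ℤ → Fin n → Fin n → ℤ
bidiagonal {n} a b c i j =
  a i when (i ≟ j) + - b i when (suc (toℕ i) ℕ.≟ toℕ j) + c when (toℕ j ℕ.≟ 0 ×-dec suc (toℕ i) ℕ.≟ n)

det-bidiagonal : ∀ n (a b : Fin (suc n) → ℤ) c (A : Fin (suc n) → Fin (suc n) → ℤ) →
                 (∀ i j → A i j ≡ bidiagonal a b c i j) → det (suc n) A ≡ prodℤ (suc n) a + c * prodℤ n (b ∘ inject₁)
det-bidiagonal zero a b c A A≗ = trans (cong (λ x → + 1 * (x * + 1) + + 0) (A≗ zero zero)) (corner (a zero) c)
  where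
  corner : ∀ x c → + 1 * ((x + + 0 + c) * + 1) + + 0 ≡ x * + 1 + c * + 1
  corner = solve-∀
det-bidiagonal (suc n) a b c A A≗ = begin
  det (suc (suc n)) A
    ≡⟨ det-expand n A (λ j → A≗ zero (suc (suc j))) ⟩
  A zero zero * det (suc n) (minor A zero) - A zero (suc zero) * det (suc n) (minor A (suc zero))
    ≡⟨ cong₂ (λ x y → x * det (suc n) (minor A zero) - y * det (suc n) (minor A (suc zero))) (A≗ zero zero) (A≗ zero (suc zero)) ⟩
  (a zero + + 0 + + 0) * det (suc n) (minor A zero) - (+ 0 + - b zero + + 0) * det (suc n) (minor A (suc zero))
    ≡⟨ cong₂ (λ D₀ D₁ → (a zero + + 0 + + 0) * D₀ - (+ 0 + - b zero + + 0) * D₁)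
             (det-bidiagonal n (a ∘ suc) (b ∘ suc) (+ 0) (minor A zero) minor₀≗)
             (det-bidiagonal n a′ (b ∘ suc) c (minor A (suc zero)) minor₁≗) ⟩
  (a zero + + 0 + + 0) * (prodℤ (suc n) (a ∘ suc) + + 0 * B) - (+ 0 + - b zero + + 0) * (+ 0 * prodℤ n (a′ ∘ suc) + c * B)
    ≡⟨ collect (a zero) (prodℤ (suc n) (a ∘ suc)) (b zero) c B (prodℤ n (a′ ∘ suc)) ⟩
  prodℤ (suc (suc n)) a + c * prodℤ (suc n) (b ∘ inject₁)
    ∎
  where
  open ≡-Reasoning
  B = prodℤ n (b ∘ suc ∘ inject₁)
  a′ : Fin (suc n) → ℤ
  a′ zero    = + 0
  a′ (suc i) = a (suc (suc i))
  minor₀≗ : ∀ r c′ → minor A zero r c′ ≡ bidiagonal (a ∘ suc) (b ∘ suc) (+ 0) r c′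
  minor₀≗ r c′ = trans (A≗ (suc r) (suc c′))
    (cong (λ t → a (suc r) when (r ≟ c′) + - b (suc r) when (suc (toℕ r) ℕ.≟ toℕ c′) + t)
          (sym (0-when (toℕ c′ ℕ.≟ 0 ×-dec suc (toℕ r) ℕ.≟ suc n))))
  minor₁≗ : ∀ r c′ → minor A (suc zero) r c′ ≡ bidiagonal a′ (b ∘ suc) c r c′
  minor₁≗ zero    zero     = A≗ (suc zero) zero
  minor₁≗ (suc r) zero     = A≗ (suc (suc r)) zero
  minor₁≗ zero    (suc c′) = A≗ (suc zero) (suc (suc c′))
  minor₁≗ (suc r) (suc c′) = A≗ (suc (suc r)) (suc (suc c′))
  collect : ∀ a₀ P b₀ c B X → (a₀ + + 0 + + 0) * (P + + 0 * B) - (+ 0 + - b₀ + + 0) * (+ 0 * X + c * B) ≡ a₀ * P + c * (b₀ * B)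
  collect = solve-∀

-- Coordinates with respect to w̃

toℚ-injective : ∀ {x y} → toℚ x ≡ toℚ y → x ≡ y
toℚ-injective {x} {y} eq with ℚₚ.fromℚᵘ-injective {mkℚᵘ x 0} {mkℚᵘ y 0} eq
... | *≡* x*1≡y*1 = trans (sym (ℤₚ.*-identityʳ x)) (trans x*1≡y*1 (ℤₚ.*-identityʳ y))

toℚ-homo-− : ∀ x y → toℚ (x - y) ≡ toℚ x ℚ.- toℚ y
toℚ-homo-− x y = ℚₚ.toℚᵘ-injective (begin
  ℚ.toℚᵘ (toℚ (x - y))                         ≈⟨ ℚₚ.toℚᵘ-fromℚᵘ (mkℚᵘ (x - y) 0) ⟩
  mkℚᵘ (x - y) 0                               ≈⟨ *≡* (unnormalised x y) ⟩
  mkℚᵘ x 0 ℚᵘ.- mkℚᵘ y 0                       ≈⟨ ℚᵘₚ.+-cong (toℚᵘ∘toℚ x) (ℚᵘₚ.-‿cong (toℚᵘ∘toℚ y)) ⟨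
  ℚ.toℚᵘ (toℚ x) ℚᵘ.- ℚ.toℚᵘ (toℚ y)           ≈⟨ ℚᵘₚ.+-congʳ (ℚ.toℚᵘ (toℚ x)) (ℚₚ.toℚᵘ-homo‿- (toℚ y)) ⟨
  ℚ.toℚᵘ (toℚ x) ℚᵘ.+ ℚ.toℚᵘ (ℚ.- toℚ y)       ≈⟨ ℚₚ.toℚᵘ-homo-+ (toℚ x) (ℚ.- toℚ y) ⟨
  ℚ.toℚᵘ (toℚ x ℚ.- toℚ y)                     ∎)
  where
  open ℚᵘₚ.≃-Reasoning
  toℚᵘ∘toℚ : ∀ z → ℚ.toℚᵘ (toℚ z) ℚᵘ.≃ mkℚᵘ z 0
  toℚᵘ∘toℚ z = ℚₚ.toℚᵘ-fromℚᵘ (mkℚᵘ z 0)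
  unnormalised : ∀ x y → (x - y) * + 1 ≡ (x * + 1 + - y * + 1) * + 1
  unnormalised = solve-∀

module _ (d : ℕ) where
  open import Data.Rational.Solver using (module +-*-Solver)
  open +-*-Solver

  private
    1/[d+1] : ℚ
    1/[d+1] = + 1 ℚ./ suc d

  w-diagonal : ∀ j → w d j j ≡ ℚ.1ℚ ℚ.- 1/[d+1]
  w-diagonal j with j ≟ j
  ... | yes _  = refl
  ... | no j≢j = contradiction refl j≢j

  w-elsewhere : ∀ {i j} → i ≢ j → w d i j ≡ ℚ.0ℚ ℚ.- 1/[d+1]
  w-elsewhere {i} {j} i≢j with i ≟ j
  ... | yes i≡j = contradiction i≡j i≢j
  ... | no _    = refl

  comb-formula : ∀ a j → comb d a j ≡ toℚ (a j) ℚ.- ℚΣ.sum (toℚ ∘ a) ℚ.* 1/[d+1]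
  comb-formula a j = begin
    comb d a j                                   ≡⟨ sumℚ≡sum (suc d) (λ i → X i ℚ.* w d i j) ⟩
    ℚΣ.sum (λ i → X i ℚ.* w d i j)               ≡⟨ ℚΣ.sum-remove (λ i → X i ℚ.* w d i j) ⟩
    X j ℚ.* w d j j ℚ.+ ℚΣ.sum (λ l → X (punchIn j l) ℚ.* w d (punchIn j l) j)
      ≡⟨ cong₂ (λ u v → X j ℚ.* u ℚ.+ v) (w-diagonal j)
               (ℚΣ.sum-cong-≗ λ l → cong (X (punchIn j l) ℚ.*_) (w-elsewhere (Finₚ.punchInᵢ≢i j l))) ⟩
    X j ℚ.* (ℚ.1ℚ ℚ.- 1/[d+1]) ℚ.+ ℚΣ.sum (λ l → X (punchIn j l) ℚ.* (ℚ.0ℚ ℚ.- 1/[d+1]))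
      ≡⟨ cong (X j ℚ.* (ℚ.1ℚ ℚ.- 1/[d+1]) ℚ.+_) (sym (ℚΣ.*-distribʳ-sum (ℚ.0ℚ ℚ.- 1/[d+1]) (removeAt X j))) ⟩
    X j ℚ.* (ℚ.1ℚ ℚ.- 1/[d+1]) ℚ.+ R ℚ.* (ℚ.0ℚ ℚ.- 1/[d+1])
      ≡⟨ regroup (X j) R 1/[d+1] ⟩
    X j ℚ.- (X j ℚ.+ R) ℚ.* 1/[d+1]              ≡⟨ cong (λ s → X j ℚ.- s ℚ.* 1/[d+1]) (sym (ℚΣ.sum-remove X)) ⟩
    X j ℚ.- ℚΣ.sum X ℚ.* 1/[d+1]                 ∎
    where
    open ≡-Reasoning
    X = toℚ ∘ a
    R = ℚΣ.sum (removeAt X j)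
    regroup : ∀ x r q → x ℚ.* (ℚ.1ℚ ℚ.- q) ℚ.+ r ℚ.* (ℚ.0ℚ ℚ.- q) ≡ x ℚ.- (x ℚ.+ r) ℚ.* q
    regroup = solve 3 (λ x r q → x :* (con ℚ.1ℚ :- q) :+ r :* (con ℚ.0ℚ :- q) := x :- (x :+ r) :* q) refl

  comb-cong : ∀ {a a'} → (∀ i → a i ≡ a' i) → comb d a ≈ comb d a'
  comb-cong {a} {a'} a≗a' j = begin
    comb d a j                                      ≡⟨ comb-formula a j ⟩
    toℚ (a j) ℚ.- ℚΣ.sum (toℚ ∘ a) ℚ.* 1/[d+1]
      ≡⟨ cong₂ (λ u s → toℚ u ℚ.- s ℚ.* 1/[d+1]) (a≗a' j) (ℚΣ.sum-cong-≗ (cong toℚ ∘ a≗a')) ⟩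
    toℚ (a' j) ℚ.- ℚΣ.sum (toℚ ∘ a') ℚ.* 1/[d+1]    ≡⟨ comb-formula a' j ⟨
    comb d a' j                                     ∎
    where open ≡-Reasoning

  comb-homo-− : ∀ a a' j → comb d (λ i → a i - a' i) j ≡ comb d a j ℚ.- comb d a' j
  comb-homo-− a a' j = begin
    comb d (λ i → a i - a' i) j
      ≡⟨ comb-formula (λ i → a i - a' i) j ⟩
    toℚ (a j - a' j) ℚ.- ℚΣ.sum (λ i → toℚ (a i - a' i)) ℚ.* 1/[d+1]
      ≡⟨ cong₂ (λ u s → u ℚ.- s ℚ.* 1/[d+1]) (toℚ-homo-− (a j) (a' j))
               (trans (ℚΣ.sum-cong-≗ (λ i → toℚ-homo-− (a i) (a' i)))
                      (∑-distrib-− ℚₚ.+-*-commutativeRing (toℚ ∘ a) (toℚ ∘ a'))) ⟩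
    (toℚ (a j) ℚ.- toℚ (a' j)) ℚ.- (ℚΣ.sum (toℚ ∘ a) ℚ.- ℚΣ.sum (toℚ ∘ a')) ℚ.* 1/[d+1]
      ≡⟨ solve 5 (λ x x' s s' q → (x :- x') :- (s :- s') :* q := (x :- s :* q) :- (x' :- s' :* q)) refl
               (toℚ (a j)) (toℚ (a' j)) (ℚΣ.sum (toℚ ∘ a)) (ℚΣ.sum (toℚ ∘ a')) 1/[d+1] ⟩
    (toℚ (a j) ℚ.- ℚΣ.sum (toℚ ∘ a) ℚ.* 1/[d+1]) ℚ.- (toℚ (a' j) ℚ.- ℚΣ.sum (toℚ ∘ a') ℚ.* 1/[d+1])
      ≡⟨ cong₂ ℚ._-_ (comb-formula a j) (comb-formula a' j) ⟨
    comb d a j ℚ.- comb d a' j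
      ∎
    where open ≡-Reasoning

  comb-≈⇒difference-constant : ∀ {a a'} → comb d a ≈ comb d a' → ∀ j → a j - a' j ≡ a zero - a' zero
  comb-≈⇒difference-constant {a} {a'} ca≈ca' j = toℚ-injective (trans (gap j) (sym (gap zero)))
    where
    S S' : ℚ
    S  = ℚΣ.sum (toℚ ∘ a)
    S' = ℚΣ.sum (toℚ ∘ a')
    gap : ∀ j → toℚ (a j - a' j) ≡ (S ℚ.- S') ℚ.* 1/[d+1]
    gap j = begin
      toℚ (a j - a' j)                                          ≡⟨ toℚ-homo-− (a j) (a' j) ⟩
      toℚ (a j) ℚ.- toℚ (a' j)
        ≡⟨ solve 5 (λ x x' s s' q → x :- x' := (x :- s :* q) :- (x' :- s' :* q) :+ (s :- s') :* q) refl x x' S S' 1/[d+1] ⟩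
      (x ℚ.- S ℚ.* 1/[d+1]) ℚ.- (x' ℚ.- S' ℚ.* 1/[d+1]) ℚ.+ (S ℚ.- S') ℚ.* 1/[d+1]
        ≡⟨ cong (λ u → u ℚ.- (x' ℚ.- S' ℚ.* 1/[d+1]) ℚ.+ (S ℚ.- S') ℚ.* 1/[d+1])
                (trans (sym (comb-formula a j)) (trans (ca≈ca' j) (comb-formula a' j))) ⟩
      (x' ℚ.- S' ℚ.* 1/[d+1]) ℚ.- (x' ℚ.- S' ℚ.* 1/[d+1]) ℚ.+ (S ℚ.- S') ℚ.* 1/[d+1]
        ≡⟨ solve 2 (λ u v → u :- u :+ v := v) refl (x' ℚ.- S' ℚ.* 1/[d+1]) ((S ℚ.- S') ℚ.* 1/[d+1]) ⟩
      (S ℚ.- S') ℚ.* 1/[d+1]                                    ∎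
      where
      open ≡-Reasoning
      x = toℚ (a j)
      x' = toℚ (a' j)

prev : ∀ {d} → Fin (suc d) → Fin (suc d)
prev {d} zero = fromℕ d
prev (suc i)  = inject₁ i

toℕ-next : ∀ {d} (i : Fin (suc d)) → toℕ (next i) ≡ suc (toℕ i) % suc d
toℕ-next {d} i = Finₚ.toℕ-fromℕ< (m%n<n (suc (toℕ i)) (suc d))

next-≡-of-suc : ∀ {d} {i j : Fin (suc d)} → suc (toℕ i) ≡ toℕ j → next i ≡ j
next-≡-of-suc {d} {i} {j} 1+i≡j = Finₚ.toℕ-injective (begin
  toℕ (next i)         ≡⟨ toℕ-next i ⟩
  suc (toℕ i) % suc d  ≡⟨ cong (_% suc d) 1+i≡j ⟩
  toℕ j % suc d        ≡⟨ m<n⇒m%n≡m (Finₚ.toℕ<n j) ⟩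
  toℕ j                ∎)
  where open ≡-Reasoning

next-≡-of-wrap : ∀ {d} {i j : Fin (suc d)} → toℕ j ≡ 0 × suc (toℕ i) ≡ suc d → next i ≡ j
next-≡-of-wrap {d} {i} {j} (j≡0 , 1+i≡1+d) = Finₚ.toℕ-injective (begin
  toℕ (next i)         ≡⟨ toℕ-next i ⟩
  suc (toℕ i) % suc d  ≡⟨ cong (_% suc d) 1+i≡1+d ⟩
  suc d % suc d        ≡⟨ n%n≡0 (suc d) ⟩
  0                    ≡⟨ j≡0 ⟨
  toℕ j                ∎)
  where open ≡-Reasoning

next-inject₁ : ∀ {d} (i : Fin d) → next (inject₁ i) ≡ suc i
next-inject₁ i = next-≡-of-suc (cong suc (Finₚ.toℕ-inject₁ i))

next-fromℕ : ∀ d → next (fromℕ d) ≡ zero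
next-fromℕ d = next-≡-of-wrap (refl , cong suc (Finₚ.toℕ-fromℕ d))

next-prev : ∀ {d} (j : Fin (suc d)) → next (prev j) ≡ j
next-prev {d} zero = next-fromℕ d
next-prev (suc i)  = next-inject₁ i

prev-next : ∀ {d} (i : Fin (suc d)) → prev (next i) ≡ i
prev-next {d} i with Top.view i
... | Top.‵fromℕ     = cong prev (next-fromℕ d)
... | Top.‵inject₁ x = cong prev (next-inject₁ x)

prev≢ : ∀ {d} → 1 ℕ.≤ d → (j : Fin (suc d)) → prev j ≢ j
prev≢ {suc d} _ (suc i) eq = ℕₚ.1+n≢n (sym (trans (sym (Finₚ.toℕ-inject₁ i)) (cong toℕ eq)))

reach-zero : ∀ {n} (P : Fin (suc n) → Set) → (∀ (x : Fin n) → P (suc x) → P (inject₁ x)) → ∀ j → P j → P zero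
reach-zero         P step zero    Pj = Pj
reach-zero {suc n} P step (suc j) Pj = step zero (reach-zero (P ∘ suc) (step ∘ suc) j Pj)

reach-all : ∀ {n} (P : Fin (suc n) → Set) → (∀ (x : Fin n) → P (suc x) → P (inject₁ x)) → P (fromℕ n) → ∀ x → P x
reach-all {zero}  P step Ptop zero    = Ptop
reach-all {suc n} P step Ptop zero    = step zero (reach-all (P ∘ suc) (step ∘ suc) Ptop zero)
reach-all {suc n} P step Ptop (suc x) = reach-all (P ∘ suc) (step ∘ suc) Ptop x

prev-closed⇒all : ∀ {d} (P : Fin (suc d) → Set) → (∀ x → P x → P (prev x)) → ∀ j → P j → ∀ x → P x
prev-closed⇒all P step j Pj =
  reach-all P (step ∘ suc) (step zero (reach-zero P (step ∘ suc) j Pj))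

Bounded : ∀ {n} → (Fin n → ℕ) → (Fin n → ℕ) → Set
Bounded k f = ∀ i → f i ℕ.≤ k i

Fundamental : ∀ {n} → (Fin n → ℕ) → (Fin n → ℕ) → Set
Fundamental k f = Bounded k f × ∃[ i ] f i ≡ 0

module _ {d : ℕ} (k : Fin (suc d) → ℕ) where

  M-diagonal : ∀ j → M d k j j ≡ + suc (k j)
  M-diagonal j with j ≟ j
  ... | yes _  = refl
  ... | no j≢j = contradiction refl j≢j

  M-superdiagonal : 1 ℕ.≤ d → ∀ j → M d k (prev j) j ≡ - + k j
  M-superdiagonal 1≤d j with prev j ≟ j
  ... | yes eq = contradiction eq (prev≢ 1≤d j)
  ... | no _ with next (prev j) ≟ j
  ...   | yes eq = cong (λ i → - + k i) eq
  ...   | no neq = contradiction (next-prev j) neq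

  M-elsewhere : ∀ {i j} → i ≢ j → i ≢ prev j → M d k i j ≡ + 0
  M-elsewhere {i} {j} i≢j i≢prev with i ≟ j
  ... | yes eq = contradiction eq i≢j
  ... | no _ with next i ≟ j
  ...   | yes eq = contradiction (trans (sym (prev-next i)) (cong prev eq)) i≢prev
  ...   | no _   = refl

  M≡bidiagonal : 1 ℕ.≤ d → ∀ i j → M d k i j ≡ bidiagonal (λ i → + suc (k i)) (λ i → + k (next i)) (- + k zero) i j
  M≡bidiagonal 1≤d i j with i ≟ j
  ... | yes refl = sym (trans
      (cong₂ (λ y z → + suc (k i) + y + z)
             (when-no (suc (toℕ i) ℕ.≟ toℕ i) ℕₚ.1+n≢n)
             (when-no (toℕ i ℕ.≟ 0 ×-dec suc (toℕ i) ℕ.≟ suc d) no-wrap))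
      (trans (ℤₚ.+-identityʳ _) (ℤₚ.+-identityʳ _)))
    where
    no-wrap : ¬ (toℕ i ≡ 0 × suc (toℕ i) ≡ suc d)
    no-wrap (i≡0 , 1+i≡1+d) = ℕₚ.<⇒≢ 1≤d (sym (trans (sym (ℕₚ.suc-injective 1+i≡1+d)) i≡0))
  ... | no _ with next i ≟ j
  ...   | no next≢j = sym
      (cong₂ (λ y z → + 0 + y + z)
             (when-no (suc (toℕ i) ℕ.≟ toℕ j) (next≢j ∘ next-≡-of-suc))
             (when-no (toℕ j ℕ.≟ 0 ×-dec suc (toℕ i) ℕ.≟ suc d) (next≢j ∘ next-≡-of-wrap)))
  ...   | yes refl with Top.view i
  ...     | Top.‵fromℕ = sym (trans
      (cong₂ (λ y z → + 0 + y + z)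
             (when-no (suc (toℕ (fromℕ d)) ℕ.≟ toℕ (next (fromℕ d)))
                      (λ eq → ℕₚ.1+n≢0 (trans eq (cong toℕ (next-fromℕ d)))))
             (when-yes (toℕ (next (fromℕ d)) ℕ.≟ 0 ×-dec suc (toℕ (fromℕ d)) ℕ.≟ suc d)
                       (cong toℕ (next-fromℕ d) , cong suc (Finₚ.toℕ-fromℕ d))))
      (trans (ℤₚ.+-identityˡ _) (cong (λ i → - + k i) (sym (next-fromℕ d)))))
  ...     | Top.‵inject₁ x = sym (trans
      (cong₂ (λ y z → + 0 + y + z)
             (when-yes (suc (toℕ (inject₁ x)) ℕ.≟ toℕ (next (inject₁ x)))
                       (trans (cong suc (Finₚ.toℕ-inject₁ x)) (sym (cong toℕ (next-inject₁ x)))))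
             (when-no (toℕ (next (inject₁ x)) ℕ.≟ 0 ×-dec suc (toℕ (inject₁ x)) ℕ.≟ suc d)
                      (λ (j≡0 , _) → ℕₚ.1+n≢0 (trans (sym (cong toℕ (next-inject₁ x))) j≡0))))
      (trans (ℤₚ.+-identityʳ _) (ℤₚ.+-identityˡ _)))

  det-M : 1 ℕ.≤ d → det (suc d) (M d k) ≡ prodℤ (suc d) (λ i → + suc (k i)) - prodℤ (suc d) (λ i → + k i)
  det-M 1≤d = begin
    det (suc d) (M d k)
      ≡⟨ det-bidiagonal d _ _ _ (M d k) (M≡bidiagonal 1≤d) ⟩
    Π[1+k] + - + k zero * prodℤ d (λ i → + k (next (inject₁ i)))
      ≡⟨ cong (λ P → Π[1+k] + - + k zero * P) (prodℤ-cong d (λ i → cong (λ j → + k j) (next-inject₁ i))) ⟩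
    Π[1+k] + - + k zero * prodℤ d (λ i → + k (suc i))
      ≡⟨ cong (λ x → Π[1+k] + x) (ℤₚ.neg-distribˡ-* (+ k zero) _) ⟨
    Π[1+k] - prodℤ (suc d) (λ i → + k i) ∎
    where
    open ≡-Reasoning
    Π[1+k] = prodℤ (suc d) (λ i → + suc (k i))

  infix 8 _·M

  _·M : (Fin (suc d) → ℤ) → Fin (suc d) → ℤ
  (β ·M) j = β j * + suc (k j) - β (prev j) * + k j

  rowMul-M : 1 ℕ.≤ d → ∀ β j → rowMul d β (M d k) j ≡ (β ·M) j
  rowMul-M 1≤d β j = begin
    rowMul d β (M d k) j                                  ≡⟨ sumℤ≡sum (suc d) (λ i → β i * M d k i j) ⟩
    ℤΣ.sum (λ i → β i * M d k i j)
      ≡⟨ sum-pair ℤₚ.+-0-commutativeMonoid _ j≢prev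
                  (λ i i≢j i≢prev → trans (cong (β i *_) (M-elsewhere i≢j i≢prev)) (ℤₚ.*-zeroʳ (β i))) ⟩
    β j * M d k j j + β (prev j) * M d k (prev j) j
      ≡⟨ cong₂ (λ x y → β j * x + β (prev j) * y) (M-diagonal j) (M-superdiagonal 1≤d j) ⟩
    β j * + suc (k j) + β (prev j) * - + k j
      ≡⟨ cong (λ y → β j * + suc (k j) + y) (sym (ℤₚ.neg-distribʳ-* (β (prev j)) (+ k j))) ⟩
    (β ·M) j
      ∎
    where
    open ≡-Reasoning
    j≢prev : j ≢ prev j
    j≢prev = prev≢ 1≤d j ∘ sym

  ·M-const : ∀ c j → ((λ _ → c) ·M) j ≡ c
  ·M-const c j = constant c (+ k j)
    where
    constant : ∀ c k → c * (+ 1 + k) - c * k ≡ c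
    constant = solve-∀

  ·M-neg : ∀ β j → ((λ i → - β i) ·M) j ≡ - (β ·M) j
  ·M-neg β j = neg (β j) (β (prev j)) (+ suc (k j)) (+ k j)
    where
    neg : ∀ x y K k → - x * K - - y * k ≡ - (x * K - y * k)
    neg = solve-∀

  ·M-+ : ∀ β γ j → ((λ i → β i + γ i) ·M) j ≡ (β ·M) j + (γ ·M) j
  ·M-+ β γ j = additive (β j) (γ j) (β (prev j)) (γ (prev j)) (+ suc (k j)) (+ k j)
    where
    additive : ∀ x x' y y' K k → (x + x') * K - (y + y') * k ≡ (x * K - y * k) + (x' * K - y' * k)
    additive = solve-∀

  ·M-shift : ∀ β c j → ((λ i → β i + c) ·M) j ≡ (β ·M) j + c
  ·M-shift β c j = trans (·M-+ β (λ _ → c) j) (cong (λ y → (β ·M) j + y) (·M-const c j))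

  infix 4 _∼_

  record _∼_ (a a' : Fin (suc d) → ℤ) : Set where
    constructor by
    field
      coefficients : Fin (suc d) → ℤ
      difference   : ∀ j → a j - a' j ≡ (coefficients ·M) j

  ∼-trans : ∀ {a a' a''} → a ∼ a' → a' ∼ a'' → a ∼ a''
  ∼-trans {a} {a'} {a''} (by β eq) (by γ eq') = by (λ i → β i + γ i) λ j → begin
    a j - a'' j                    ≡⟨ split (a j) (a' j) (a'' j) ⟩
    (a j - a' j) + (a' j - a'' j)  ≡⟨ cong₂ _+_ (eq j) (eq' j) ⟩
    (β ·M) j + (γ ·M) j            ≡⟨ ·M-+ β γ j ⟨
    ((λ i → β i + γ i) ·M) j       ∎
    where
    open ≡-Reasoning
    split : ∀ x y z → x - z ≡ (x - y) + (y - z)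
    split = solve-∀

  ≗⇒∼ : ∀ {a a'} → (∀ j → a j ≡ a' j) → a ∼ a'
  ≗⇒∼ {a} {a'} eq = by (λ _ → + 0) λ j →
    trans (cong (λ y → a j - y) (sym (eq j))) (trans (ℤₚ.+-inverseʳ (a j)) (sym (·M-const (+ 0) j)))

  Cong⇒∼ : 1 ℕ.≤ d → ∀ {v v' a a'} → v ≈ comb d a → v' ≈ comb d a' → Cong d k v v' → a ∼ a'
  Cong⇒∼ 1≤d {a = a} {a'} v≈ v'≈ (b , v-v'≈) = by (λ i → b i + c) λ j → begin
    a j - a' j                     ≡⟨ split (a j - a' j) (R j) ⟩
    R j + (a j - a' j - R j)       ≡⟨ cong₂ _+_ (rowMul-M 1≤d b j) (comb-≈⇒difference-constant d {λ i → a i - a' i} {R} comb≈ j) ⟩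
    (b ·M) j + c                   ≡⟨ ·M-shift b c j ⟨
    ((λ i → b i + c) ·M) j         ∎
    where
    open ≡-Reasoning
    R = rowMul d b (M d k)
    c = a zero - a' zero - R zero
    comb≈ : comb d (λ i → a i - a' i) ≈ comb d R
    comb≈ j = trans (comb-homo-− d a a' j) (trans (cong₂ ℚ._-_ (sym (v≈ j)) (sym (v'≈ j))) (v-v'≈ j))
    split : ∀ x r → x ≡ r + (x - r)
    split = solve-∀

  ∼⇒Cong : 1 ℕ.≤ d → ∀ {v v' a a'} → v ≈ comb d a → v' ≈ comb d a' → a ∼ a' → Cong d k v v'
  ∼⇒Cong 1≤d {v} {v'} {a} {a'} v≈ v'≈ (by β eq) = β , λ j → begin
    v j ℚ.- v' j                          ≡⟨ cong₂ ℚ._-_ (v≈ j) (v'≈ j) ⟩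
    comb d a j ℚ.- comb d a' j            ≡⟨ comb-homo-− d a a' j ⟨
    comb d (λ i → a i - a' i) j           ≡⟨ comb-cong d (λ i → trans (eq i) (sym (rowMul-M 1≤d β i))) j ⟩
    comb d (rowMul d β (M d k)) j         ∎
    where open ≡-Reasoning

  -- Uniqueness of fundamental representatives

  ·M-increment : ∀ β x → (β ·M) x ≡ β x + + k x * (β x - β (prev x))
  ·M-increment β x = increment (β x) (β (prev x)) (+ k x)
    where
    increment : ∀ b p k → b * (+ 1 + k) - p * k ≡ b + k * (b - p)
    increment = solve-∀

  β≥prev⇒β≤β·M : ∀ β x → β (prev x) ≤ β x → β x ≤ (β ·M) x
  β≥prev⇒β≤β·M β x βp≤βx = begin
    β x                                ≡⟨ trans (sym (ℤₚ.+-identityʳ (β x))) (cong (λ y → β x + y) (sym (ℤₚ.*-zeroʳ (+ k x)))) ⟩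
    β x + + k x * + 0                  ≤⟨ ℤₚ.+-monoʳ-≤ (β x) (ℤₚ.*-monoˡ-≤-nonNeg (+ k x) (ℤₚ.i≤j⇒0≤j-i βp≤βx)) ⟩
    β x + + k x * (β x - β (prev x))   ≡⟨ ·M-increment β x ⟨
    (β ·M) x                           ∎
    where open ℤₚ.≤-Reasoning

  β>prev⇒β+k≤β·M : ∀ β x → β (prev x) < β x → β x + + k x ≤ (β ·M) x
  β>prev⇒β+k≤β·M β x βp<βx = begin
    β x + + k x                        ≡⟨ cong (λ y → β x + y) (sym (ℤₚ.*-identityʳ (+ k x))) ⟩
    β x + + k x * + 1                  ≤⟨ ℤₚ.+-monoʳ-≤ (β x) (ℤₚ.*-monoˡ-≤-nonNeg (+ k x) 1≤βx-βp) ⟩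
    β x + + k x * (β x - β (prev x))   ≡⟨ ·M-increment β x ⟨
    (β ·M) x                           ∎
    where
    open ℤₚ.≤-Reasoning
    cancel : ∀ p → + 1 ≡ + 1 + p - p
    cancel = solve-∀
    1≤βx-βp : + 1 ≤ β x - β (prev x)
    1≤βx-βp = begin
      + 1                              ≡⟨ cancel (β (prev x)) ⟩
      + 1 + β (prev x) - β (prev x)    ≤⟨ ℤₚ.+-monoˡ-≤ (- β (prev x)) (ℤₚ.i<j⇒suc[i]≤j βp<βx) ⟩
      β x - β (prev x)                 ∎

  module _ {f f' : Fin (suc d) → ℕ} {β} (f≤k : ∀ j → f j ℕ.≤ k j) (f-f'≡ : ∀ j → + f j - + f' j ≡ (β ·M) j) where

    private
      ·M≤k : ∀ j → (β ·M) j ≤ + k j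
      ·M≤k j = ℤₚ.≤-trans (ℤₚ.≤-reflexive (sym (f-f'≡ j))) (ℤₚ.≤-trans (ℤₚ.i-j≤i (+ f j) (+ f' j)) (+≤+ (f≤k j)))

      positive⇒≤prev : ∀ x → + 1 ≤ β x → β x ≤ β (prev x)
      positive⇒≤prev x 1≤βx with β x ℤₚ.≤? β (prev x)
      ... | yes βx≤βp = βx≤βp
      ... | no  βx≰βp = contradiction (begin-strict
        + k x          <⟨ +<+ (ℕₚ.n<1+n (k x)) ⟩
        + 1 + + k x    ≤⟨ ℤₚ.+-monoˡ-≤ (+ k x) 1≤βx ⟩
        β x + + k x    ≤⟨ β>prev⇒β+k≤β·M β x (ℤₚ.≰⇒> βx≰βp) ⟩
        (β ·M) x       ≤⟨ ·M≤k x ⟩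
        + k x          ∎) (ℤₚ.<-irrefl refl)
        where open ℤₚ.≤-Reasoning

    ·M-coefficients-nonpositive : ∀ {i} → f i ≡ 0 → ∀ j → β j ≤ + 0
    ·M-coefficients-nonpositive {i} fi≡0 j with β j ℤₚ.≤? + 0
    ... | yes βj≤0 = βj≤0
    ... | no  βj≰0 = contradiction (begin-strict
      + 0           <⟨ +<+ (s≤s z≤n) ⟩
      + 1           ≤⟨ positive i ⟩
      β i           ≤⟨ β≥prev⇒β≤β·M β i βp≤βi ⟩
      (β ·M) i      ≡⟨ f-f'≡ i ⟨
      + f i - + f' i ≤⟨ ℤₚ.i-j≤i (+ f i) (+ f' i) ⟩
      + f i         ≡⟨ cong +_ fi≡0 ⟩
      + 0           ∎) (ℤₚ.<-irrefl refl)
      where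
      open ℤₚ.≤-Reasoning
      positive : ∀ x → + 1 ≤ β x
      positive = prev-closed⇒all (λ x → + 1 ≤ β x) (λ x 1≤βx → ℤₚ.≤-trans 1≤βx (positive⇒≤prev x 1≤βx))
                   j (ℤₚ.i<j⇒suc[i]≤j (ℤₚ.≰⇒> βj≰0))
      βp≤βi : β (prev i) ≤ β i
      βp≤βi = prev-closed⇒all (λ x → β (prev i) ≤ β x) (λ x le → ℤₚ.≤-trans le (positive⇒≤prev x (positive x)))
                (prev i) ℤₚ.≤-refl i

  fundamental-∼⇒≗ : ∀ {f f'} → Fundamental k f → Fundamental k f' → (λ j → + f j) ∼ (λ j → + f' j) → ∀ j → f j ≡ f' j
  fundamental-∼⇒≗ {f} {f'} (f≤k , _ , fi≡0) (f'≤k , _ , f'i'≡0) (by β f-f'≡) j =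
    ℤₚ.+-injective (ℤₚ.i-j≡0⇒i≡j (+ f j) (+ f' j) (trans (f-f'≡ j) ·M≡0))
    where
    f'-f≡ : ∀ j → + f' j - + f j ≡ ((λ i → - β i) ·M) j
    f'-f≡ j = trans (swap (+ f' j) (+ f j)) (trans (cong -_ (f-f'≡ j)) (sym (·M-neg β j)))
      where
      swap : ∀ x y → x - y ≡ - (y - x)
      swap = solve-∀
    β≡0 : ∀ j → β j ≡ + 0
    β≡0 j = ℤₚ.≤-antisym (·M-coefficients-nonpositive {f' = f'} {β = β} f≤k f-f'≡ fi≡0 j)
                         (ℤₚ.neg-cancel-≤ (·M-coefficients-nonpositive {f' = f} {β = λ i → - β i} f'≤k f'-f≡ f'i'≡0 j))
    ·M≡0 : (β ·M) j ≡ + 0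
    ·M≡0 = trans (cong₂ (λ b p → b * + suc (k j) - p * + k j) (β≡0 j) (β≡0 (prev j)))
                 (cong₂ _-_ (ℤₚ.*-zeroˡ (+ suc (k j))) (ℤₚ.*-zeroˡ (+ k j)))

  -- Existence of fundamental representatives

  Represented : (Fin (suc d) → ℤ) → Set
  Represented a = ∃[ f ] Fundamental k f × a ∼ (λ j → + f j)

  ∼-sub-·M : ∀ a β → a ∼ (λ j → a j - (β ·M) j)
  ∼-sub-·M a β = by β λ j → cancel (a j) ((β ·M) j)
    where
    cancel : ∀ x y → x - (x - y) ≡ y
    cancel = solve-∀

  W : Fin (suc d) → ℕ
  W j = ℕΠ.sum (removeAt (suc ∘ k) j)

  1≤W : ∀ j → 1 ℕ.≤ W j
  1≤W j = 1≤product (removeAt (suc ∘ k) j) (λ _ → s≤s z≤n)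

  W*[1+k]≡Π[1+k] : ∀ j → + W j * + suc (k j) ≡ + ℕΠ.sum (suc ∘ k)
  W*[1+k]≡Π[1+k] j = trans (sym (ℤₚ.pos-* (W j) (suc (k j))))
                           (cong +_ (trans (ℕₚ.*-comm (W j) (suc (k j))) (sym (ℕΠ.sum-remove (suc ∘ k)))))

  μ : (Fin (suc d) → ℤ) → ℤ
  μ a = ℤΣ.sum (λ j → + W j * a j)

  μ-nonneg : ∀ a → (∀ j → + 0 ≤ a j) → + 0 ≤ μ a
  μ-nonneg a 0≤a = sum-nonneg _ (λ j → nonneg-* (W j) (0≤a j))

  μ-− : ∀ a b → μ (λ j → a j - b j) ≡ μ a - μ b
  μ-− a b = trans (ℤΣ.sum-cong-≗ (λ j → distrib (+ W j) (a j) (b j)))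
                  (∑-distrib-− ℤₚ.+-*-commutativeRing (λ j → + W j * a j) (λ j → + W j * b j))
    where
    distrib : ∀ w x y → w * (x - y) ≡ w * x - w * y
    distrib = solve-∀

  μ-sub-·M : ∀ a β → + 1 ≤ μ (β ·M) → μ (λ j → a j - (β ·M) j) < μ a
  μ-sub-·M a β 1≤μβM = begin-strict
    μ (λ j → a j - (β ·M) j)  ≡⟨ μ-− a (β ·M) ⟩
    μ a - μ (β ·M)            <⟨ ℤₚ.+-monoʳ-< (μ a) (ℤₚ.neg-mono-< (ℤₚ.<-≤-trans (+<+ (s≤s z≤n)) 1≤μβM)) ⟩
    μ a + - + 0               ≡⟨ ℤₚ.+-identityʳ (μ a) ⟩
    μ a                       ∎
    where open ℤₚ.≤-Reasoning

  μ-δ·M : ∀ i → μ (δ i ·M) ≡ + W (next i)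
  μ-δ·M i = begin
    ℤΣ.sum (λ j → + W j * (δ i j * + suc (k j) - δ i (prev j) * + k j))
      ≡⟨ ℤΣ.sum-cong-≗ (λ j → distrib (+ W j) (δ i j) (+ suc (k j)) (δ i (prev j)) (+ k j)) ⟩
    ℤΣ.sum (λ j → A j - B j)
      ≡⟨ ∑-distrib-− ℤₚ.+-*-commutativeRing A B ⟩
    ℤΣ.sum A - ℤΣ.sum B
      ≡⟨ cong₂ _-_ (sum-single ℤₚ.+-0-commutativeMonoid A i (λ j j≢i → vanish (δ-elsewhere (j≢i ∘ sym))))
                   (sum-single ℤₚ.+-0-commutativeMonoid B n (λ j j≢n → vanish (δ-elsewhere (j≢n ∘ prev≡⇒≡next j)))) ⟩
    A i - B n
      ≡⟨ cong₂ _-_ (unit (δ-diagonal i)) (unit (trans (cong (δ i) (prev-next i)) (δ-diagonal i))) ⟩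
    + W i * + suc (k i) - + W n * + k n
      ≡⟨ cong (λ x → x - + W n * + k n) (trans (W*[1+k]≡Π[1+k] i) (sym (W*[1+k]≡Π[1+k] n))) ⟩
    + W n * (+ 1 + + k n) - + W n * + k n
      ≡⟨ telescope (+ W n) (+ k n) ⟩
    + W n ∎
    where
    open ≡-Reasoning
    n = next i
    A B : Fin (suc d) → ℤ
    A j = δ i j * (+ W j * + suc (k j))
    B j = δ i (prev j) * (+ W j * + k j)
    prev≡⇒≡next : ∀ j → i ≡ prev j → j ≡ n
    prev≡⇒≡next j i≡pj = trans (sym (next-prev j)) (cong next (sym i≡pj))
    distrib : ∀ w x K y k → w * (x * K - y * k) ≡ x * (w * K) - y * (w * k)
    distrib = solve-∀
    vanish : ∀ {x y} → x ≡ + 0 → x * y ≡ + 0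
    vanish {y = y} refl = ℤₚ.*-zeroˡ y
    unit : ∀ {x y} → x ≡ + 1 → x * y ≡ y
    unit {y = y} refl = ℤₚ.*-identityˡ y
    telescope : ∀ w k → w * (+ 1 + k) - w * k ≡ w
    telescope = solve-∀

  1≤μ[1·M] : + 1 ≤ μ ((λ _ → + 1) ·M)
  1≤μ[1·M] = begin
    + 1                                   ≤⟨ +≤+ (1≤W zero) ⟩
    + W zero                              ≡⟨ trans (ℤₚ.+-identityʳ (+ W zero * + 1)) (ℤₚ.*-identityʳ (+ W zero)) ⟨
    + W zero * + 1 + + 0                  ≤⟨ ℤₚ.+-monoʳ-≤ (+ W zero * + 1) (sum-nonneg _ (λ j → nonneg-* (W (suc j)) (+≤+ z≤n))) ⟩
    ℤΣ.sum (λ j → + W j * + 1)            ≡⟨ ℤΣ.sum-cong-≗ (λ j → cong (λ x → + W j * x) (·M-const (+ 1) j)) ⟨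
    μ ((λ _ → + 1) ·M)                    ∎
    where open ℤₚ.≤-Reasoning

  reduction-step : (a : Fin (suc d) → ℤ) → (∀ j → + 0 ≤ a j) →
                   (∃[ f ] Fundamental k f × (∀ j → a j ≡ + f j)) ⊎
                   (∃[ β ] (∀ j → + 0 ≤ a j - (β ·M) j) × + 1 ≤ μ (β ·M))
  reduction-step a 0≤a with Finₚ.any? (λ i → + suc (k i) ℤₚ.≤? a i)
  ... | yes (i , K≤ai) = inj₂ (δ i , fired-nonneg , ℤₚ.≤-trans (+≤+ (1≤W (next i))) (ℤₚ.≤-reflexive (sym (μ-δ·M i))))
    where
    fired-nonneg : ∀ j → + 0 ≤ a j - (δ i ·M) j
    fired-nonneg j = subst (+ 0 ≤_) (sym (regroup (a j) (δ i j) (+ suc (k j)) (δ i (prev j)) (+ k j)))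
                       (ℤₚ.+-mono-≤ (ℤₚ.i≤j⇒0≤j-i (emptied j)) (nonneg-* (k j) (δ-nonneg i (prev j))))
      where
      regroup : ∀ a x K y k → a - (x * K - y * k) ≡ a - x * K + k * y
      regroup = solve-∀
      emptied : ∀ j → δ i j * + suc (k j) ≤ a j
      emptied j with i ≟ j
      ... | yes refl = ℤₚ.≤-trans (ℤₚ.≤-reflexive (ℤₚ.*-identityˡ _)) K≤ai
      ... | no _     = ℤₚ.≤-trans (ℤₚ.≤-reflexive (ℤₚ.*-zeroˡ (+ suc (k j)))) (0≤a j)
  ... | no none-full with Finₚ.any? (λ i → a i ℤₚ.≟ + 0)
  ...   | yes (i , ai≡0) =
    inj₁ ((λ j → ℤ.∣ a j ∣) , (bounded , i , cong ℤ.∣_∣ ai≡0) , λ j → sym (ℤₚ.0≤i⇒+∣i∣≡i (0≤a j)))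
    where
    bounded : ∀ j → ℤ.∣ a j ∣ ℕ.≤ k j
    bounded j = ℤₚ.drop‿+≤+ (subst (_≤ + k j) (sym (ℤₚ.0≤i⇒+∣i∣≡i (0≤a j)))
                  (ℤₚ.i<j⇒i≤pred[j] (ℤₚ.≰⇒> (λ K≤aj → none-full (j , K≤aj)))))
  ...   | no none-zero = inj₂ ((λ _ → + 1) , lowered-nonneg , 1≤μ[1·M])
    where
    lowered-nonneg : ∀ j → + 0 ≤ a j - ((λ _ → + 1) ·M) j
    lowered-nonneg j = subst (λ x → + 0 ≤ a j - x) (sym (·M-const (+ 1) j))
      (ℤₚ.i≤j⇒0≤j-i (ℤₚ.i<j⇒suc[i]≤j (ℤₚ.≤∧≢⇒< (0≤a j) (λ 0≡aj → none-zero (j , sym 0≡aj)))))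

  ∼-represented : ∀ {a a'} → a ∼ a' → Represented a' → Represented a
  ∼-represented a∼a' (f , F , a'∼f) = f , F , ∼-trans a∼a' a'∼f

  nonneg-represented : ∀ m (a : Fin (suc d) → ℤ) → (∀ j → + 0 ≤ a j) → μ a ≤ + m → Represented a
  nonneg-represented m a 0≤a μa≤m with reduction-step a 0≤a
  ... | inj₁ (f , F , a≗f) = f , F , ≗⇒∼ a≗f
  ... | inj₂ (β , 0≤a' , 1≤μβM) = ∼-represented (∼-sub-·M a β) (recurse m μa≤m)
    where
    a' : Fin (suc d) → ℤ
    a' j = a j - (β ·M) j
    μa'<μa : μ a' < μ a
    μa'<μa = μ-sub-·M a β 1≤μβM
    recurse : ∀ m → μ a ≤ + m → Represented a'
    recurse zero    μa≤0   = contradiction (ℤₚ.≤-<-trans (μ-nonneg a' 0≤a') (ℤₚ.<-≤-trans μa'<μa μa≤0)) (ℤₚ.<-irrefl refl)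
    recurse (suc m) μa≤1+m = nonneg-represented m a' 0≤a' (ℤₚ.i<j⇒i≤pred[j] (ℤₚ.<-≤-trans μa'<μa μa≤1+m))

  represented : ∀ a → Represented a
  represented a = ∼-represented a∼a⁺
    (nonneg-represented ℤ.∣ μ a⁺ ∣ a⁺ 0≤a⁺ (ℤₚ.≤-reflexive (sym (ℤₚ.0≤i⇒+∣i∣≡i (μ-nonneg a⁺ 0≤a⁺)))))
    where
    C : ℤ
    C = ℤΣ.sum (λ j → + ℤ.∣ a j ∣)
    a⁺ : Fin (suc d) → ℤ
    a⁺ j = a j + C
    0≤a⁺ : ∀ j → + 0 ≤ a⁺ j
    0≤a⁺ j = ℤₚ.≤-trans (0≤i+∣i∣ (a j)) (ℤₚ.+-monoʳ-≤ (a j) (term≤sum (λ j → + ℤ.∣ a j ∣) (λ _ → +≤+ z≤n) j))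
    a∼a⁺ : a ∼ a⁺
    a∼a⁺ = by (λ _ → - C) λ j → trans (cancel (a j) C) (sym (·M-const (- C) j))
      where
      cancel : ∀ x c → x - (x + c) ≡ - c
      cancel = solve-∀

-- Enumerating fundamental vectors

record Enumeration (I : Set) {n} (P : (Fin n → ℕ) → Set) : Set where
  field
    enum      : I → Fin n → ℕ
    sound     : ∀ t → P (enum t)
    injective : ∀ {t t'} → (∀ j → enum t j ≡ enum t' j) → t ≡ t'
    complete  : ∀ {f} → P f → ∃[ t ] (∀ j → enum t j ≡ f j)

module _ {n} {P : (Fin n → ℕ) → Set} where

  reindex : ∀ {I J} → I ↔ J → Enumeration J P → Enumeration I P
  reindex I↔J E = record
    { enum      = E.enum ∘ to
    ; sound     = E.sound ∘ to
    ; injective = λ {t} {t'} eq → trans (sym (strictlyInverseʳ t)) (trans (cong from (E.injective eq)) (strictlyInverseʳ t'))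
    ; complete  = λ Pf → let s , eq = E.complete Pf in from s , λ j → trans (cong (λ s → E.enum s j) (strictlyInverseˡ s)) (eq j)
    }
    where
    module E = Enumeration E
    open Inverse I↔J

  resp-⇔ : ∀ {I} {Q : (Fin n → ℕ) → Set} → (∀ f → P f ⇔ Q f) → Enumeration I P → Enumeration I Q
  resp-⇔ P⇔Q E = record
    { enum      = E.enum
    ; sound     = λ t → Equivalence.to (P⇔Q _) (E.sound t)
    ; injective = E.injective
    ; complete  = λ Qf → E.complete (Equivalence.from (P⇔Q _) Qf)
    }
    where module E = Enumeration E

  enumeration-⊎ : ∀ {I J} {Q : (Fin n → ℕ) → Set} → (∀ {f g} → P f → Q g → ¬ (∀ j → f j ≡ g j)) →
                  Enumeration I P → Enumeration J Q → Enumeration (I ⊎ J) (λ f → P f ⊎ Q f)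
  enumeration-⊎ disjoint E F = record
    { enum      = [ E.enum , F.enum ]′
    ; sound     = λ { (inj₁ s) → inj₁ (E.sound s) ; (inj₂ t) → inj₂ (F.sound t) }
    ; injective = injective
    ; complete  = λ { (inj₁ Pf) → let s , eq = E.complete Pf in inj₁ s , eq
                    ; (inj₂ Qf) → let t , eq = F.complete Qf in inj₂ t , eq }
    }
    where
    module E = Enumeration E
    module F = Enumeration F
    injective : ∀ {u u'} → (∀ j → [ E.enum , F.enum ]′ u j ≡ [ E.enum , F.enum ]′ u' j) → u ≡ u'
    injective {inj₁ s} {inj₁ s'} eq = cong inj₁ (E.injective eq)
    injective {inj₁ s} {inj₂ t'} eq = contradiction eq (disjoint (E.sound s) (F.sound t'))
    injective {inj₂ t} {inj₁ s'} eq = contradiction (sym ∘ eq) (disjoint (E.sound s') (F.sound t))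
    injective {inj₂ t} {inj₂ t'} eq = cong inj₂ (F.injective eq)

HeadIn : ℕ → ℕ → ∀ {n} → (Fin (suc n) → ℕ) → Set
HeadIn o m f = o ℕ.≤ f zero × f zero ℕ.∸ o ℕ.< m

enumeration-∷ : ∀ {n} {I} {P : (Fin n → ℕ) → Set} o m → Enumeration I P →
                Enumeration (Fin m × I) (λ f → HeadIn o m f × P (f ∘ suc))
enumeration-∷ o m E = record
  { enum      = λ (x , s) → (o ℕ.+ toℕ x) ∷ E.enum s
  ; sound     = λ (x , s) → (ℕₚ.m≤m+n o (toℕ x) , subst (ℕ._< m) (sym (ℕₚ.m+n∸m≡n o (toℕ x))) (Finₚ.toℕ<n x)) , E.sound s
  ; injective = λ {(x , s)} {(x' , s')} eq →
      cong₂ _,_ (Finₚ.toℕ-injective (ℕₚ.+-cancelˡ-≡ o (toℕ x) (toℕ x') (eq zero))) (E.injective (eq ∘ suc))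
  ; complete  = λ ((o≤f₀ , f₀∸o<m) , Ptail) → let s , eq = E.complete Ptail in
      (Fin.fromℕ< f₀∸o<m , s) , λ { zero → trans (cong (o ℕ.+_) (Finₚ.toℕ-fromℕ< f₀∸o<m)) (ℕₚ.m+[n∸m]≡n o≤f₀)
                                  ; (suc j) → eq j }
  }
  where module E = Enumeration E

boxCount : ∀ {n} → (Fin n → ℕ) → ℕ
boxCount {zero}  k = 1
boxCount {suc n} k = suc (k zero) ℕ.* boxCount (k ∘ suc)

fundamentalCount : ∀ {n} → (Fin n → ℕ) → ℕ
fundamentalCount {zero}  k = 0
fundamentalCount {suc n} k = 1 ℕ.* boxCount (k ∘ suc) ℕ.+ k zero ℕ.* fundamentalCount (k ∘ suc)

boxes : ∀ {n} (k : Fin n → ℕ) → Enumeration (Fin (boxCount k)) (Bounded k)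
boxes {zero} k = record
  { enum      = λ _ ()
  ; sound     = λ _ ()
  ; injective = λ { {zero} {zero} _ → refl }
  ; complete  = λ _ → zero , λ ()
  }
boxes {suc n} k = reindex Finₚ.*↔× (resp-⇔ (λ f → mk⇔ to from) (enumeration-∷ 0 (suc (k zero)) (boxes (k ∘ suc))))
  where
  to : ∀ {f} → HeadIn 0 (suc (k zero)) f × Bounded (k ∘ suc) (f ∘ suc) → Bounded k f
  to ((_ , f₀<1+k₀) , _)     zero    = ℕₚ.≤-pred f₀<1+k₀
  to (_ , tail-bounded) (suc i) = tail-bounded i
  from : ∀ {f} → Bounded k f → HeadIn 0 (suc (k zero)) f × Bounded (k ∘ suc) (f ∘ suc)
  from f≤k = (z≤n , s≤s (f≤k zero)) , f≤k ∘ suc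

fundamentals : ∀ {n} (k : Fin n → ℕ) → Enumeration (Fin (fundamentalCount k)) (Fundamental k)
fundamentals {zero} k = record
  { enum      = λ ()
  ; sound     = λ ()
  ; injective = λ { {()} }
  ; complete  = λ { (_ , () , _) }
  }
fundamentals {suc n} k = reindex Finₚ.+↔⊎ (resp-⇔ (λ f → mk⇔ to from) (enumeration-⊎ disjoint
  (reindex Finₚ.*↔× (enumeration-∷ 0 1 (boxes (k ∘ suc))))
  (reindex Finₚ.*↔× (enumeration-∷ 1 (k zero) (fundamentals (k ∘ suc))))))
  where
  HeadZero HeadPositive : (Fin (suc n) → ℕ) → Set
  HeadZero f     = HeadIn 0 1 f × Bounded (k ∘ suc) (f ∘ suc)
  HeadPositive f = HeadIn 1 (k zero) f × Fundamental (k ∘ suc) (f ∘ suc)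

  disjoint : ∀ {f g} → HeadZero f → HeadPositive g → ¬ (∀ j → f j ≡ g j)
  disjoint ((_ , f₀<1) , _) ((1≤g₀ , _) , _) f≗g =
    ℕₚ.<-irrefl refl (ℕₚ.≤-<-trans (subst (1 ℕ.≤_) (sym (f≗g zero)) 1≤g₀) f₀<1)

  to : ∀ {f} → HeadZero f ⊎ HeadPositive f → Fundamental k f
  to {f} (inj₁ ((_ , f₀<1) , tail-bounded)) = bounded , zero , f₀≡0
    where
    f₀≡0 : f zero ≡ 0
    f₀≡0 = ℕₚ.n<1⇒n≡0 f₀<1
    bounded : Bounded k f
    bounded zero    = subst (ℕ._≤ k zero) (sym f₀≡0) z≤n
    bounded (suc i) = tail-bounded i
  to {f} (inj₂ ((1≤f₀ , f₀∸1<k₀) , tail-bounded , i , fi≡0)) = bounded , suc i , fi≡0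
    where
    bounded : Bounded k f
    bounded zero    = subst (ℕ._≤ k zero) (ℕₚ.m+[n∸m]≡n 1≤f₀) f₀∸1<k₀
    bounded (suc i) = tail-bounded i

  from : ∀ {f} → Fundamental k f → HeadZero f ⊎ HeadPositive f
  from {f} (f≤k , i , fi≡0) with f zero ℕ.≟ 0
  ... | yes f₀≡0 = inj₁ ((z≤n , subst (ℕ._< 1) (sym f₀≡0) (s≤s z≤n)) , f≤k ∘ suc)
  ... | no  f₀≢0 with i
  ...   | zero   = contradiction fi≡0 f₀≢0
  ...   | suc i' = inj₂ ((1≤f₀ , subst (ℕ._≤ k zero) (sym (ℕₚ.m+[n∸m]≡n 1≤f₀)) (f≤k zero)) , f≤k ∘ suc , i' , fi≡0)
    where
    1≤f₀ : 1 ℕ.≤ f zero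
    1≤f₀ = ℕₚ.n≢0⇒n>0 f₀≢0

boxCount≡prod : ∀ {n} (k : Fin n → ℕ) → + boxCount k ≡ prodℤ n (λ i → + suc (k i))
boxCount≡prod {zero}  k = refl
boxCount≡prod {suc n} k = trans (ℤₚ.pos-* (suc (k zero)) (boxCount (k ∘ suc)))
                                (cong (λ x → + suc (k zero) * x) (boxCount≡prod (k ∘ suc)))

fundamentalCount≡prod−prod : ∀ {n} (k : Fin n → ℕ) →
                             + fundamentalCount k ≡ prodℤ n (λ i → + suc (k i)) - prodℤ n (λ i → + k i)
fundamentalCount≡prod−prod {zero}  k = refl
fundamentalCount≡prod−prod {suc n} k = begin
  + (1 ℕ.* boxCount (k ∘ suc) ℕ.+ k zero ℕ.* fundamentalCount (k ∘ suc))
    ≡⟨ ℤₚ.pos-+ (1 ℕ.* boxCount (k ∘ suc)) (k zero ℕ.* fundamentalCount (k ∘ suc)) ⟩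
  + (1 ℕ.* boxCount (k ∘ suc)) + + (k zero ℕ.* fundamentalCount (k ∘ suc))
    ≡⟨ cong₂ _+_ (ℤₚ.pos-* 1 (boxCount (k ∘ suc))) (ℤₚ.pos-* (k zero) (fundamentalCount (k ∘ suc))) ⟩
  + 1 * + boxCount (k ∘ suc) + + k zero * + fundamentalCount (k ∘ suc)
    ≡⟨ cong₂ (λ b f → + 1 * b + + k zero * f) (boxCount≡prod (k ∘ suc)) (fundamentalCount≡prod−prod (k ∘ suc)) ⟩
  + 1 * P + + k zero * (P - Q)
    ≡⟨ expand P Q (+ k zero) ⟩
  (+ 1 + + k zero) * P - + k zero * Q
    ∎
  where
  open ≡-Reasoning
  P = prodℤ n (λ i → + suc (k (suc i)))
  Q = prodℤ n (λ i → + k (suc i))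
  expand : ∀ P Q k → + 1 * P + k * (P - Q) ≡ (+ 1 + k) * P - k * Q
  expand = solve-∀

quotCard : ∀ d → 1 ℕ.≤ d → (k : Fin (suc d) → ℕ) → QuotCard d k (fundamentalCount k)
quotCard d 1≤d k = r , (λ t → (+_ ∘ F.enum t) , λ _ → refl) , injective , surjective
  where
  module F = Enumeration (fundamentals k)
  r : Fin (fundamentalCount k) → Vecℚ d
  r t = comb d (+_ ∘ F.enum t)
  injective : ∀ t t' → Cong d k (r t) (r t') → t ≡ t'
  injective t t' r∼r' = F.injective (fundamental-∼⇒≗ k (F.sound t) (F.sound t') (Cong⇒∼ k 1≤d (λ _ → refl) (λ _ → refl) r∼r'))
  surjective : ∀ v → InΛ d v → ∃[ t ] Cong d k v (r t)
  surjective v (a , v≈) = via (represented k a)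
    where
    via : Represented k a → ∃[ t ] Cong d k v (r t)
    via (f , fundamental , a∼f) =
      let t , t≗f = F.complete fundamental
      in t , ∼⇒Cong k 1≤d v≈ (λ _ → refl) (∼-trans k a∼f (≗⇒∼ k (λ j → cong +_ (sym (t≗f j)))))

repSystem : ∀ d → 1 ℕ.≤ d → (k : Fin (suc d) → ℕ) → RepSystem d k
repSystem d 1≤d k = (λ { v (f , _ , _ , v≈) → (+_ ∘ f) , v≈ }) , representative , unique
  where
  representative : ∀ v → InΛ d v → ∃[ f ] (InF d k f × Cong d k v f)
  representative v (a , v≈) =
    let f , (f≤k , zero-at) , a∼f = represented k a
    in comb d (+_ ∘ f) , (f , f≤k , zero-at , λ _ → refl) , ∼⇒Cong k 1≤d v≈ (λ _ → refl) a∼f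
  unique : ∀ v v' → InF d k v → InF d k v' → Cong d k v v' → v ≈ v'
  unique v v' (f , f≤k , zero-at , v≈) (f' , f'≤k , zero-at' , v'≈) v∼v' j = begin
    v j                ≡⟨ v≈ j ⟩
    comb d (+_ ∘ f) j  ≡⟨ comb-cong d (cong +_ ∘ f≗f') j ⟩
    comb d (+_ ∘ f') j ≡⟨ v'≈ j ⟨
    v' j               ∎
    where
    open ≡-Reasoning
    f≗f' : ∀ i → f i ≡ f' i
    f≗f' = fundamental-∼⇒≗ k (f≤k , zero-at) (f'≤k , zero-at') (Cong⇒∼ k 1≤d v≈ v'≈ v∼v')

lemma4p3 : ∀ (d : ℕ) → 1 ℕ.≤ d → (k : Fin (suc d) → ℕ) → (∀ i → 1 ℕ.≤ k i) →
    (∃[ N ] (QuotCard d k N × (+ N ≡ det (suc d) (M d k)) ×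
    (det (suc d) (M d k) ≡ prodℤ (suc d) (λ i → + suc (k i)) ℤ.- prodℤ (suc d) (λ i → + k i))))
    × RepSystem d k
lemma4p3 d 1≤d k _ =
  ( fundamentalCount k
  , quotCard d 1≤d k
  , trans (fundamentalCount≡prod−prod k) (sym (det-M k 1≤d))
  , det-M k 1≤d )
  , repSystem d 1≤d k
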